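{- Fix $r\geq 3$. Let $G$ be a graph on $n$ vertices, $U\subseteq V(G)$, and $\varphi_U$ a proper $3$-coloring of $G[U]$ with colors $\{1,2,3\}$. Construct a graph $H$ with an $r$-coloring $\varphi$ as follows: take a copy of $G$ and color all its vertices with color $1$; for each $v\in V(G)$ add $r-3$ groups of $n+1$ new pendant vertices adjacent only to $v$, where the $i$-th group ($1\le i\le r-3$) is colored $3+i$; for each $u\in U$ add two further groups of $n+1$ new pendant vertices adjacent only to $u$, the two groups colored with the two distinct colors of $\{1,2,3\}\setminus\{\varphi_U(u)\}$. Then there exists a proper $3$-coloring of $G$ (with colors $\{1,2,3\}$) agreeing with $\varphi_U$ on $U$ if and only if there exists a proper $r$-coloring $\varphi''$ of $H$ such that $\varphi''$ and $\varphi$ differ on at most $n$ vertices.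
   Context: An $r$-coloring of a graph is any map from its vertex set to $\{1,\dots,r\}$; it is proper if adjacent vertices receive different colors. -}

module Defs where

open import Data.Nat using (ℕ; suc; _≤_; _∸_)
open import Data.Nat.Properties using (m+[n∸m]≡n)
open import Data.Fin using (Fin; zero; suc; inject≤; cast; _↑ʳ_; punchIn)
open import Data.Fin.Subset using (Subset; _∈_)
open import Data.Empty using (⊥)
open import Relation.Binary.PropositionalEquality using (_≡_; _≢_)

record Graph (n : ℕ) : Set₁ where
  field
    Adj   : Fin n → Fin n → Set
    sym   : ∀ {u v} → Adj u v → Adj v u
    irrefl : ∀ {u} → Adj u u → ⊥
open Graph public

Proper : {V : Set} → (V → V → Set) → {k : ℕ} → (V → Fin k) → Set
Proper {V} E c = ∀ (x y : V) → E x y → c x ≢ c y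

-- Proper 3-coloring φU of the induced subgraph G[U]
-- (colors 1,2,3 are represented by Fin 3 = {0,1,2}).
ProperOnInduced : ∀ {n} → Graph n → (U : Subset n) → ((u : Fin n) → u ∈ U → Fin 3) → Set
ProperOnInduced {n} G U φU =
  ∀ (u v : Fin n) (pu : u ∈ U) (pv : v ∈ U) → Adj G u v → φU u pu ≢ φU v pv

-- Vertices of H.
--   base v          : the copy of v ∈ V(G)
--   pend v i j      : j-th vertex (of n+1) in the i-th group (of r-3) of pendants at v
--   upend u p g j   : j-th vertex (of n+1) in group g (of 2) of pendants at u ∈ U
data HV (n : ℕ) (U : Subset n) (r : ℕ) : Set where
  base  : Fin n → HV n U r
  pend  : Fin n → Fin (r ∸ 3) → Fin (suc n) → HV n U r
  upend : (u : Fin n) → u ∈ U → Fin 2 → Fin (suc n) → HV n U r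

HAdj : ∀ {n} (G : Graph n) (U : Subset n) (r : ℕ) → HV n U r → HV n U r → Set
HAdj G U r (base u)          (base v)          = Adj G u v
HAdj G U r (base v)          (pend w _ _)      = v ≡ w
HAdj G U r (pend w _ _)      (base v)          = w ≡ v
HAdj G U r (base v)          (upend w _ _ _)   = v ≡ w
HAdj G U r (upend w _ _ _)   (base v)          = w ≡ v
HAdj G U r _                 _                 = ⊥

-- The r-coloring φ of H (colors 1..r represented by Fin r = {0,..,r-1}).
--   copies of G      : color 1
--   pendant group i  : color 3+i (i = 1..r-3), i.e. index 3 + i (0-based i)
--   U-pendant group g: the g-th color of {1,2,3} ∖ {φU u} (punchIn skips φU u)
Hcol : ∀ {n} (U : Subset n) (φU : (u : Fin n) → u ∈ U → Fin 3) (r : ℕ) → 3 ≤ r →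
       HV n U r → Fin r
Hcol U φU r 3≤r (base _)          = inject≤ (zero {2}) 3≤r
Hcol U φU r 3≤r (pend _ i _)      = cast (m+[n∸m]≡n 3≤r) (3 ↑ʳ i)
Hcol U φU r 3≤r (upend u p g _)   = inject≤ (punchIn (φU u p) g) 3≤r

-- A vertex v of H carries n + 1 pendants of every colour 4, …, r, and, when v ∈ U, of both
-- colours of {1,2,3} ∖ {φU v}. A recolouring that changes at most n vertices leaves one
-- pendant of each such group untouched, so v cannot take any of these colours: v gets a colour
-- in {1,2,3}, equal to φU v on U, and restricting to the copy of G is the required 3-colouring.
-- Conversely, recolouring the copy of G by a 3-colouring c changes only the n base vertices.
module Submission where

open import Defs hiding (sym)
open import Data.Nat using (ℕ; _≤_; _<_; _+_; _∸_; suc; s≤s)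
open import Data.Nat.Properties using (m+[n∸m]≡n; ≤-reflexive; <⇒≱; m≤m+n; ≮⇒≥; ∸-monoˡ-<; _<?_; module ≤-Reasoning)
open import Data.Fin using (Fin; toℕ; fromℕ<; inject≤; cast; _↑ʳ_; punchIn)
open import Data.Fin.Properties
  using (toℕ-injective; toℕ-inject≤; toℕ-cast; toℕ-↑ʳ; toℕ-fromℕ<; toℕ<n; punchInᵢ≢i; punchIn-punchOut; injective⇒≤; _≟_)
open import Data.Fin.Subset using (Subset; _∈_)
open import Data.List using (List; length; map; allFin; lookup)
open import Data.List.Properties using (length-map; length-tabulate)
open import Data.List.Membership.Propositional using () renaming (_∈_ to _∈ₗ_)
open import Data.List.Membership.Propositional.Properties using (∈-map⁺; ∈-allFin)
open import Data.List.Relation.Unary.Any using (index)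
open import Data.List.Relation.Unary.Any.Properties using (lookup-index)
open import Data.Product using (Σ; ∃; _×_; _,_; proj₁; proj₂)
open import Function.Base using (_∘_)
open import Function.Bundles using (_⇔_; mk⇔)
open import Function.Definitions using (Injective)
open import Relation.Nullary using (yes; no; contradiction)
open import Relation.Binary.PropositionalEquality using (_≡_; _≢_; refl; sym; trans; cong; module ≡-Reasoning)

injective-⊆⇒≤-length : ∀ {A : Set} {m} {L : List A} (f : Fin m → A) → Injective _≡_ _≡_ f →
                       (f∈L : ∀ j → f j ∈ₗ L) → m ≤ length L
injective-⊆⇒≤-length {L = L} f f-inj f∈L = injective⇒≤ index-inj
  where
  index-inj : Injective _≡_ _≡_ (λ j → index (f∈L j))
  index-inj {i} {j} eq = f-inj (begin
    f i                      ≡⟨ lookup-index (f∈L i) ⟩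
    lookup L (index (f∈L i)) ≡⟨ cong (lookup L) eq ⟩
    lookup L (index (f∈L j)) ≡⟨ lookup-index (f∈L j) ⟨
    f j                      ∎)
    where open ≡-Reasoning

avoids-all-punchIn⇒≡ : ∀ {m} {a x : Fin (suc m)} → (∀ g → x ≢ punchIn a g) → x ≡ a
avoids-all-punchIn⇒≡ {a = a} {x} avoids with x ≟ a
... | yes x≡a = x≡a
... | no  x≢a = contradiction (sym (punchIn-punchOut (x≢a ∘ sym))) (avoids _)

module _ {V : Set} {k : ℕ} (E : V → V → Set) {φ ψ : V → Fin k} (φ-proper : Proper E φ)
         {L : List V} (covers : ∀ x → φ x ≢ ψ x → x ∈ₗ L) where

  avoids-colour-of-many-neighbours : ∀ {m} {c : Fin k} (x : V) (f : Fin m → V) → Injective _≡_ _≡_ f →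
    length L < m → (∀ j → E x (f j)) → (∀ j → ψ (f j) ≡ c) → φ x ≢ c
  avoids-colour-of-many-neighbours x f f-inj L<m adj ψf≡c φx≡c =
    <⇒≱ L<m (injective-⊆⇒≤-length f f-inj f∈L)
    where
    f∈L : ∀ j → f j ∈ₗ L
    f∈L j = covers (f j) λ φfj≡ψfj →
      φ-proper x (f j) (adj j) (trans φx≡c (sym (trans φfj≡ψfj (ψf≡c j))))

module Colours (r : ℕ) (3≤r : 3 ≤ r) where

  lowColour : Fin 3 → Fin r
  lowColour a = inject≤ a 3≤r

  pendantColour : Fin (r ∸ 3) → Fin r
  pendantColour i = cast (m+[n∸m]≡n 3≤r) (3 ↑ʳ i)

  toℕ-pendantColour : ∀ i → toℕ (pendantColour i) ≡ 3 + toℕ i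
  toℕ-pendantColour i = trans (toℕ-cast _ (3 ↑ʳ i)) (toℕ-↑ʳ 3 i)

  lowColour-injective : Injective _≡_ _≡_ lowColour
  lowColour-injective {a} {b} eq = toℕ-injective (begin
    toℕ a             ≡⟨ toℕ-inject≤ a 3≤r ⟨
    toℕ (lowColour a) ≡⟨ cong toℕ eq ⟩
    toℕ (lowColour b) ≡⟨ toℕ-inject≤ b 3≤r ⟩
    toℕ b             ∎)
    where open ≡-Reasoning

  lowColour≢pendantColour : ∀ a i → lowColour a ≢ pendantColour i
  lowColour≢pendantColour a i eq = <⇒≱ (toℕ<n a) (begin
    3                     ≤⟨ m≤m+n 3 (toℕ i) ⟩
    3 + toℕ i             ≡⟨ toℕ-pendantColour i ⟨
    toℕ (pendantColour i) ≡⟨ cong toℕ eq ⟨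
    toℕ (lowColour a)     ≡⟨ toℕ-inject≤ a 3≤r ⟩
    toℕ a                 ∎)
    where open ≤-Reasoning

  avoids-pendantColours⇒low : (k : Fin r) → (∀ i → k ≢ pendantColour i) → ∃ λ a → k ≡ lowColour a
  avoids-pendantColours⇒low k avoids with toℕ k <? 3
  ... | yes k<3 = fromℕ< k<3 , toℕ-injective (sym (trans (toℕ-inject≤ _ 3≤r) (toℕ-fromℕ< k<3)))
  ... | no  k≮3 = contradiction (toℕ-injective (sym (begin
      toℕ (pendantColour i) ≡⟨ toℕ-pendantColour i ⟩
      3 + toℕ i             ≡⟨ cong (3 +_) (toℕ-fromℕ< k-3<r-3) ⟩
      3 + (toℕ k ∸ 3)       ≡⟨ m+[n∸m]≡n (≮⇒≥ k≮3) ⟩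
      toℕ k                 ∎))) (avoids i)
    where
    open ≡-Reasoning
    k-3<r-3 : toℕ k ∸ 3 < r ∸ 3
    k-3<r-3 = ∸-monoˡ-< (toℕ<n k) (≮⇒≥ k≮3)
    i : Fin (r ∸ 3)
    i = fromℕ< k-3<r-3

module _ (r : ℕ) (3≤r : 3 ≤ r) {n : ℕ} (G : Graph n) (U : Subset n)
         (φU : (u : Fin n) → u ∈ U → Fin 3) where
  open Colours r 3≤r

  φ : HV n U r → Fin r
  φ = Hcol U φU r 3≤r

  Extension : Set
  Extension = Σ (Fin n → Fin 3) λ c → Proper (Adj G) c × (∀ u (p : u ∈ U) → c u ≡ φU u p)

  NearbyProperColouring : Set
  NearbyProperColouring = Σ (HV n U r → Fin r) λ φ″ → Proper (HAdj G U r) φ″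
    × Σ (List (HV n U r)) λ L → length L ≤ n × (∀ x → φ″ x ≢ φ x → x ∈ₗ L)

  recolourBase : (Fin n → Fin 3) → HV n U r → Fin r
  recolourBase c (base v) = lowColour (c v)
  recolourBase c x        = φ x

  module _ {c : Fin n → Fin 3} (c-proper : Proper (Adj G) c)
           (c-agrees : ∀ u (p : u ∈ U) → c u ≡ φU u p) where

    recolourBase-proper : Proper (HAdj G U r) (recolourBase c)
    recolourBase-proper (base u)       (base v)       uv  eq = c-proper u v uv (lowColour-injective eq)
    recolourBase-proper (base v)       (pend _ i _)   refl eq = lowColour≢pendantColour (c v) i eq
    recolourBase-proper (pend _ i _)   (base v)       refl eq = lowColour≢pendantColour (c v) i (sym eq)
    recolourBase-proper (base v)       (upend _ p g _) refl eq =
      punchInᵢ≢i (φU v p) g (sym (trans (sym (c-agrees v p)) (lowColour-injective eq)))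
    recolourBase-proper (upend _ p g _) (base v)      refl eq =
      punchInᵢ≢i (φU v p) g (sym (trans (sym (c-agrees v p)) (lowColour-injective (sym eq))))

  baseVertices : List (HV n U r)
  baseVertices = map base (allFin n)

  length-baseVertices : length baseVertices ≡ n
  length-baseVertices = trans (length-map base (allFin n)) (length-tabulate (λ v → v))

  recolourBase-differs⇒∈baseVertices : ∀ c x → recolourBase c x ≢ φ x → x ∈ₗ baseVertices
  recolourBase-differs⇒∈baseVertices c (base v)        _  = ∈-map⁺ base (∈-allFin v)
  recolourBase-differs⇒∈baseVertices c (pend _ _ _)    ne = contradiction refl ne
  recolourBase-differs⇒∈baseVertices c (upend _ _ _ _) ne = contradiction refl ne

  extension⇒nearbyProperColouring : Extension → NearbyProperColouring
  extension⇒nearbyProperColouring (c , c-proper , c-agrees) =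
    recolourBase c , recolourBase-proper c-proper c-agrees
    , baseVertices , ≤-reflexive length-baseVertices , recolourBase-differs⇒∈baseVertices c

  module _ {φ″ : HV n U r → Fin r} (φ″-proper : Proper (HAdj G U r) φ″)
           {L : List (HV n U r)} (L≤n : length L ≤ n) (covers : ∀ x → φ″ x ≢ φ x → x ∈ₗ L) where

    base-avoids-pendantGroup : ∀ v {k} (f : Fin (suc n) → HV n U r) → Injective _≡_ _≡_ f →
      (∀ j → HAdj G U r (base v) (f j)) → (∀ j → φ (f j) ≡ k) → φ″ (base v) ≢ k
    base-avoids-pendantGroup v f f-inj =
      avoids-colour-of-many-neighbours (HAdj G U r) φ″-proper covers (base v) f f-inj (s≤s L≤n)

    base-low : ∀ v → ∃ λ a → φ″ (base v) ≡ lowColour a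
    base-low v = avoids-pendantColours⇒low _ λ i →
      base-avoids-pendantGroup v (pend v i) (λ { refl → refl }) (λ _ → refl) (λ _ → refl)

    restrictToBase : Fin n → Fin 3
    restrictToBase v = proj₁ (base-low v)

    restrictToBase-proper : Proper (Adj G) restrictToBase
    restrictToBase-proper u v uv eq =
      φ″-proper (base u) (base v) uv (trans (proj₂ (base-low u)) (trans (cong lowColour eq) (sym (proj₂ (base-low v)))))

    restrictToBase-agrees : ∀ u (p : u ∈ U) → restrictToBase u ≡ φU u p
    restrictToBase-agrees u p = avoids-all-punchIn⇒≡ λ g eq →
      base-avoids-pendantGroup u (upend u p g) (λ { refl → refl }) (λ _ → refl) (λ _ → refl)
        (trans (proj₂ (base-low u)) (cong lowColour eq))

  nearbyProperColouring⇒extension : NearbyProperColouring → Extension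
  nearbyProperColouring⇒extension (φ″ , φ″-proper , L , L≤n , covers) =
    restrictToBase φ″-proper L≤n covers
    , restrictToBase-proper φ″-proper L≤n covers , restrictToBase-agrees φ″-proper L≤n covers

lemma7 : (r : ℕ) → (3≤r : 3 ≤ r) → (n : ℕ) → (G : Graph n) → (U : Subset n)
    → (φU : (u : Fin n) → u ∈ U → Fin 3) → ProperOnInduced G U φU
    → (Σ (Fin n → Fin 3) λ c → Proper (Adj G) c × (∀ (u : Fin n) (p : u ∈ U) → c u ≡ φU u p))
      ⇔ (Σ (HV n U r → Fin r) λ φ'' → Proper (HAdj G U r) φ''
          × Σ (List (HV n U r)) λ L → length L ≤ n
            × (∀ (x : HV n U r) → φ'' x ≢ Hcol U φU r 3≤r x → x ∈ₗ L))
lemma7 r 3≤r n G U φU _ = mk⇔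
  (extension⇒nearbyProperColouring r 3≤r G U φU) (nearbyProperColouring⇒extension r 3≤r G U φU)
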